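{- Let $\mathcal{C}\subseteq 2^{[n]}$ and $\mathcal{D}\subseteq 2^{[m]}$ be neural codes and let $f:\mathcal{C}\to\mathcal{D}$ be an isomorphism. Then the codeword containment graph $G_\mathcal{C}$ is connected if and only if the codeword containment graph $G_{f(\mathcal{C})}$ is connected.
   Context: A neural code on $n$ neurons is a collection of subsets of $[n]$. The codeword containment graph $G_\mathcal{C}$ of a code $\mathcal{C}$ is the undirected simple graph with vertex set $\mathcal{C}$ in which $\sigma,\tau$ are adjacent iff $\sigma\subsetneq\tau$ or $\tau\subsetneq\sigma$. For $\sigma\subseteq[n]$, the trunk of $\sigma$ in $\mathcal{C}$ is $\mathrm{Tk}_\mathcal{C}(\sigma)=\{c\in\mathcal{C}\mid \sigma\subseteq c\}$; a subset of $\mathcal{C}$ is a trunk in $\mathcal{C}$ if it is empty or equals $\mathrm{Tk}_\mathcal{C}(\sigma)$ for some $\sigma\subseteq[n]$. A function $f:\mathcal{C}\to\mathcal{D}$ is a morphism if for every trunk $T\subseteq\mathcal{D}$ the preimage $f^{ -1}(T)$ is a trunk in $\mathcal{C}$. A morphism is an isomorphism if it has an inverse function which is also a morphism. -}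

module Defs where

open import Level using (0ℓ)
open import Data.Nat using (ℕ)
open import Data.Bool using (Bool; T)
open import Data.Fin.Subset using (Subset; _⊆_; _⊂_)
open import Data.Product using (Σ; Σ-syntax; ∃; _×_; _,_; proj₁)
open import Data.Sum using (_⊎_)
open import Relation.Nullary using (¬_)
open import Relation.Unary using (Pred)
open import Relation.Binary.PropositionalEquality using (_≡_)
open import Relation.Binary.Construct.Closure.ReflexiveTransitive using (Star)
open import Function.Bundles using (_⇔_)

-- Bool-valued, so that membership proofs (T b) are unique and
-- codewords of C are exactly the elements of the type ⟦ C ⟧.
Code : ℕ → Set
Code n = Subset n → Bool

⟦_⟧ : ∀ {n} → Code n → Set
⟦_⟧ {n} C = Σ[ σ ∈ Subset n ] T (C σ)

CAdj : ∀ {n} → Pred (Subset n) 0ℓ → Subset n → Subset n → Set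
CAdj P σ τ = P σ × P τ × (σ ⊂ τ ⊎ τ ⊂ σ)

ContainmentGraphConnected : ∀ {n} → Pred (Subset n) 0ℓ → Set
ContainmentGraphConnected P = ∀ σ τ → P σ → P τ → Star (CAdj P) σ τ

asSet : ∀ {n} → Code n → Pred (Subset n) 0ℓ
asSet C σ = T (C σ)

image : ∀ {n m} {C : Code n} {D : Code m} → (⟦ C ⟧ → ⟦ D ⟧) → Pred (Subset m) 0ℓ
image {C = C} f d = ∃ λ (c : ⟦ C ⟧) → proj₁ (f c) ≡ d

Tk : ∀ {n} (C : Code n) → Subset n → Pred ⟦ C ⟧ 0ℓ
Tk C σ c = σ ⊆ proj₁ c

IsTrunk : ∀ {n} (C : Code n) → Pred ⟦ C ⟧ 0ℓ → Set
IsTrunk {n} C S = (∀ c → ¬ S c) ⊎ (Σ[ σ ∈ Subset n ] (∀ c → S c ⇔ Tk C σ c))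

IsMorphism : ∀ {n m} (C : Code n) (D : Code m) → (⟦ C ⟧ → ⟦ D ⟧) → Set₁
IsMorphism C D f = ∀ (S : Pred ⟦ D ⟧ 0ℓ) → IsTrunk D S → IsTrunk C (λ c → S (f c))

IsIsomorphism : ∀ {n m} (C : Code n) (D : Code m) → (⟦ C ⟧ → ⟦ D ⟧) → Set₁
IsIsomorphism C D f =
  IsMorphism C D f ×
  Σ[ g ∈ (⟦ D ⟧ → ⟦ C ⟧) ]
    (IsMorphism D C g × (∀ c → g (f c) ≡ c) × (∀ d → f (g d) ≡ d))

-- A morphism of codes is monotone for inclusion: the preimage of the trunk of f(c)
-- contains c, so it is a trunk Tk(σ) with σ ⊆ c, and then it contains every c' ⊇ c.
-- For an isomorphism f with inverse g, monotonicity of g makes f reflect inclusion,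
-- so f preserves strict inclusion and hence maps adjacent codewords to adjacent
-- codewords. So f carries walks of G_C to walks of G_D, and g carries them back;
-- finally f(C) = D as sets since f is surjective.
module Submission where

open import Defs
open import Data.Nat using (ℕ)
open import Data.Bool using (T)
open import Data.Empty using (⊥-elim)
open import Data.Bool.Properties using (T?; T-irrelevant)
open import Data.Fin.Properties using (any?)
open import Data.Fin.Subset using (Subset; _⊆_; _⊂_; ⊥)
open import Data.Fin.Subset.Properties using (_∈?_; ⊆-refl; ⊆-trans)
open import Data.Product using (Σ-syntax; ∃; _×_; _,_; proj₁; proj₂)
open import Data.Sum using (inj₁; inj₂; map)
open import Function.Base using (_∘_)
open import Function.Bundles using (_⇔_; mk⇔; Equivalence)
open import Function.Construct.Symmetry using (⇔-sym)
open import Level using (0ℓ)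
open import Relation.Binary.Construct.Closure.ReflexiveTransitive using (gmap)
open import Relation.Binary.PropositionalEquality using (_≡_; refl; sym; trans; cong; subst; subst₂)
open import Relation.Nullary using (¬_; yes; no; contradiction)
open import Relation.Nullary.Decidable using (_×-dec_; ¬?; decidable-stable)
open import Relation.Unary using (Pred)

private
  variable
    n m : ℕ

⊆∧⊉⇒⊂ : {p q : Subset n} → p ⊆ q → ¬ (q ⊆ p) → p ⊂ q
⊆∧⊉⇒⊂ {p = p} {q} p⊆q q⊈p with any? (λ x → x ∈? q ×-dec ¬? (x ∈? p))
... | yes (x , x∈q , x∉p) = p⊆q , x , x∈q , x∉p
... | no ∄ = contradiction (λ {x} → q⊆p {x}) q⊈p
  where
  q⊆p : q ⊆ p
  q⊆p {x} x∈q = decidable-stable (x ∈? p) (λ x∉p → ∄ (x , x∈q , x∉p))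

morphism-monotone : {C : Code n} {D : Code m} {h : ⟦ C ⟧ → ⟦ D ⟧} → IsMorphism C D h →
  ∀ c c' → proj₁ c ⊆ proj₁ c' → proj₁ (h c) ⊆ proj₁ (h c')
morphism-monotone {D = D} {h} mor c c' c⊆c'
  with mor (Tk D (proj₁ (h c))) (inj₂ (proj₁ (h c) , λ _ → mk⇔ (λ x → x) (λ x → x)))
... | inj₁ empty = ⊥-elim (empty c ⊆-refl)
... | inj₂ (_ , preimage⇔Tk) =
  Equivalence.from (preimage⇔Tk c') (⊆-trans (Equivalence.to (preimage⇔Tk c) ⊆-refl) c⊆c')

morphism-strictMono : {C : Code n} {D : Code m} {h : ⟦ C ⟧ → ⟦ D ⟧} {k : ⟦ D ⟧ → ⟦ C ⟧} →
  IsMorphism C D h → IsMorphism D C k → (∀ c → k (h c) ≡ c) →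
  ∀ c c' → proj₁ c ⊂ proj₁ c' → proj₁ (h c) ⊂ proj₁ (h c')
morphism-strictMono {h = h} mh mk kh c c' (c⊆c' , x , x∈c' , x∉c) =
  ⊆∧⊉⇒⊂ (morphism-monotone mh c c' c⊆c') hc'⊈hc
  where
  hc'⊈hc : ¬ (proj₁ (h c') ⊆ proj₁ (h c))
  hc'⊈hc hc'⊆hc = x∉c (subst₂ (λ a b → proj₁ a ⊆ proj₁ b) (kh c') (kh c)
    (morphism-monotone mk (h c') (h c) hc'⊆hc) x∈c')

map-adjacent : {P : Pred (Subset n) 0ℓ} {Q : Pred (Subset m) 0ℓ} (φ : Subset n → Subset m) →
  (∀ {σ} → P σ → Q (φ σ)) →
  (∀ {σ τ} → P σ → P τ → σ ⊂ τ → φ σ ⊂ φ τ) →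
  ∀ {σ τ} → CAdj P σ τ → CAdj Q (φ σ) (φ τ)
map-adjacent φ φ-into φ-strictMono (pσ , pτ , σ⊂τ⊎τ⊂σ) =
  φ-into pσ , φ-into pτ , map (φ-strictMono pσ pτ) (φ-strictMono pτ pσ) σ⊂τ⊎τ⊂σ

connected-onto : {P : Pred (Subset n) 0ℓ} {Q : Pred (Subset m) 0ℓ} (φ : Subset n → Subset m) →
  (∀ {σ} → P σ → Q (φ σ)) →
  (∀ {σ τ} → P σ → P τ → σ ⊂ τ → φ σ ⊂ φ τ) →
  (∀ {ρ} → Q ρ → ∃ λ σ → P σ × φ σ ≡ ρ) →
  ContainmentGraphConnected P → ContainmentGraphConnected Q
connected-onto {Q = Q} φ φ-into φ-strictMono φ-onto connP ρ ρ' qρ qρ'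
  with φ-onto qρ | φ-onto qρ'
... | σ , pσ , refl | σ' , pσ' , refl =
  gmap φ (map-adjacent {Q = Q} φ φ-into φ-strictMono) (connP σ σ' pσ pσ')

connected-resp-⇔ : {P Q : Pred (Subset n) 0ℓ} → (∀ σ → P σ ⇔ Q σ) →
  ContainmentGraphConnected P → ContainmentGraphConnected Q
connected-resp-⇔ P⇔Q =
  connected-onto (λ σ → σ) (Equivalence.to (P⇔Q _)) (λ _ _ σ⊂τ → σ⊂τ)
    (λ {ρ} qρ → ρ , Equivalence.from (P⇔Q ρ) qρ , refl)

-- The junk value ⊥ off the code is never used: only values on codewords matter.
extend : {C : Code n} {D : Code m} → (⟦ C ⟧ → ⟦ D ⟧) → Subset n → Subset m
extend {C = C} h σ with T? (C σ)
... | yes p = proj₁ (h (σ , p))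
... | no _ = ⊥

extend-codeword : {C : Code n} {D : Code m} (h : ⟦ C ⟧ → ⟦ D ⟧) →
  ∀ σ (p : T (C σ)) → extend h σ ≡ proj₁ (h (σ , p))
extend-codeword {C = C} h σ p with T? (C σ)
... | yes p' = cong (λ q → proj₁ (h (σ , q))) (T-irrelevant p' p)
... | no ¬p = contradiction p ¬p

isomorphism-preserves-connected : {C : Code n} {D : Code m} {f : ⟦ C ⟧ → ⟦ D ⟧} →
  IsIsomorphism C D f → ContainmentGraphConnected (asSet C) → ContainmentGraphConnected (asSet D)
isomorphism-preserves-connected {C = C} {D} {f} (mf , g , mg , gf , fg) =
  connected-onto (extend f) f-into f-strictMono f-onto
  where
  f-into : ∀ {σ} → T (C σ) → T (D (extend f σ))
  f-into {σ} p = subst (T ∘ D) (sym (extend-codeword f σ p)) (proj₂ (f (σ , p)))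

  f-strictMono : ∀ {σ τ} → T (C σ) → T (C τ) → σ ⊂ τ → extend f σ ⊂ extend f τ
  f-strictMono {σ} {τ} p q σ⊂τ
    rewrite extend-codeword f σ p | extend-codeword f τ q =
    morphism-strictMono mf mg gf (σ , p) (τ , q) σ⊂τ

  f-onto : ∀ {ρ} → T (D ρ) → ∃ λ σ → T (C σ) × extend f σ ≡ ρ
  f-onto {ρ} q = let (σ , p) = g (ρ , q) in
    σ , p , trans (extend-codeword f σ p) (cong proj₁ (fg (ρ , q)))

isomorphism-sym : {C : Code n} {D : Code m} {f : ⟦ C ⟧ → ⟦ D ⟧} →
  IsIsomorphism C D f → Σ[ g ∈ (⟦ D ⟧ → ⟦ C ⟧) ] IsIsomorphism D C g
isomorphism-sym {f = f} (mf , g , mg , gf , fg) = g , mg , f , mf , fg , gf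

image⇔asSet : {C : Code n} {D : Code m} (f : ⟦ C ⟧ → ⟦ D ⟧) (g : ⟦ D ⟧ → ⟦ C ⟧) →
  (∀ d → f (g d) ≡ d) → ∀ ρ → image {C = C} {D = D} f ρ ⇔ asSet D ρ
image⇔asSet f g fg ρ = mk⇔
  (λ { (c , refl) → proj₂ (f c) })
  (λ q → g (ρ , q) , cong proj₁ (fg (ρ , q)))

mainTheorem3 : ∀ {n m} (C : Code n) (D : Code m) (f : ⟦ C ⟧ → ⟦ D ⟧) →
    IsIsomorphism C D f →
    ContainmentGraphConnected (asSet C) ⇔ ContainmentGraphConnected (image {C = C} {D = D} f)
mainTheorem3 C D f iso@(_ , g , _ , _ , fg) = mk⇔
  (connected-resp-⇔ (⇔-sym ∘ image⇔asSet f g fg) ∘ isomorphism-preserves-connected iso)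
  (isomorphism-preserves-connected (proj₂ (isomorphism-sym iso)) ∘ connected-resp-⇔ (image⇔asSet f g fg))
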